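{- Let $b_{k,n}$ denote the entries of the binomial array $B(1+2x)$, so $b_{k,n}=\binom{n}{k}+2\binom{n}{k-1}$. For every integer $n\ge0$, the convolution at index $n+2$ of columns $n$ and $n+1$ equals $\frac12(9n+16)C_{n+1}$: $$(9n+16)C_{n+1}=2\sum_{i=0}^{n+2}b_{i,n}\,b_{n+2-i,n+1},$$ and for all $l\in\mathbb{Z}$, $$(9n+16)C_{n+1}=2\sum_{i=0}^{n+2}b_{i,n-l}\,b_{n+2-i,n+l+1},$$ where $C_{j}=\frac{1}{j+1}\binom{2j}{j}$ is the $j$-th Catalan number.
   Context: The binomial array $B(p(x))$ has entries $b_{k,n}$ ($k\ge0$, $n\in\mathbb{Z}$) equal to the coefficient of $x^k$ in $(1+x)^np(x)$, where for $n<0$, $(1+x)^n$ is the inverse power series. Binomial coefficients with negative upper index: $\binom{n}{k}=(-1)^k\binom{ -n+k-1}{k}$ for $n<0,k\ge0$; $\binom{n}{k}=0$ for $k<0$. -}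

module Defs where

open import Data.Nat as ℕ using (ℕ; zero; suc)
open import Data.Nat.Combinatorics using (_C_)
open import Data.Nat.DivMod using (_/_)
open import Data.Integer as ℤ using (ℤ; +_; -[1+_]; _*_; _+_)

-- Generalized binomial coefficient  binom n k  for integer upper index n
-- and natural lower index k:
--   n ≥ 0 : the usual  n choose k
--   n < 0 : (-1)^k * ((-n + k - 1) choose k)
-- (For n = -[1+ m ], i.e. n = -(m+1), we have -n + k - 1 = m + k.)
sign : ℕ → ℤ
sign zero = + 1
sign (suc k) = ℤ.- sign k

binom : ℤ → ℕ → ℤ
binom (+ n) k = + (n C k)
binom -[1+ m ] k = sign k * + ((m ℕ.+ k) C k)

binomPred : ℤ → ℕ → ℤ
binomPred n zero = + 0
binomPred n (suc k) = binom n k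

b : ℕ → ℤ → ℤ
b k n = binom n k + + 2 * binomPred n k

catalan : ℕ → ℕ
catalan j = ((2 ℕ.* j) C j) / suc j

sumTo : ℕ → (ℕ → ℤ) → ℤ
sumTo zero f = f 0
sumTo (suc N) f = sumTo N f + f (suc N)

module Submission where

open import Defs

-- Column n of B(1 + 2x) holds the coefficients of (1 + x)^n (1 + 2x), so the
-- convolution of columns a and c holds those of (1 + x)^(a + c) (1 + 2x)^2: this is
-- Vandermonde's identity for integer upper indices, proved by moving a along ℤ with
-- Pascal's rule (multiplication by 1 + x, which is injective on coefficient sequences).
-- For a + c = 2n + 1 the coefficient of x^(n+2) is C(M,n+2) + 8 C(M,n) with M = 2n + 1,
-- and the absorption identity turns this into (9n + 16) C_(n+1) / 2.

module CatalanArithmetic where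

  open import Data.Nat
  open import Data.Nat.Properties
  open import Data.Nat.Combinatorics
  open import Data.Nat.Divisibility using (divides)
  open import Data.Nat.DivMod using (m*[n/m]≡n)
  open import Data.Nat.Tactic.RingSolver using (solve-∀)
  open import Relation.Binary.PropositionalEquality
  open ≡-Reasoning

  absorption : ∀ m k → suc k * (suc m C suc k) ≡ suc m * (m C k)
  absorption m zero = trans (+-identityʳ (suc m C 1)) (trans (nC1≡n (suc m)) (sym (*-identityʳ (suc m))))
  absorption zero (suc k) = begin
    suc (suc k) * (1 C suc (suc k)) ≡⟨ cong (suc (suc k) *_) (k>n⇒nCk≡0 {1} {suc (suc k)} (s≤s (s≤s z≤n))) ⟩
    suc (suc k) * 0                 ≡⟨ *-zeroʳ (suc (suc k)) ⟩
    0                               ≡⟨ cong (1 *_) (k>n⇒nCk≡0 {0} {suc k} (s≤s z≤n)) ⟨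
    1 * (0 C suc k)                 ∎
  absorption (suc m) (suc k) = begin
    suc (suc k) * (suc (suc m) C suc (suc k))
      ≡⟨ cong (suc (suc k) *_) (nCk+nC[k+1]≡[n+1]C[k+1] (suc m) (suc k)) ⟨
    suc (suc k) * (c + c′)                        ≡⟨ split k c c′ ⟩
    suc k * c + c + suc (suc k) * c′              ≡⟨ cong₂ (λ x y → x + c + y) (absorption m k) (absorption m (suc k)) ⟩
    suc m * (m C k) + c + suc m * (m C suc k)    ≡⟨ regroup m (m C k) (m C suc k) c ⟩
    suc m * (m C k + m C suc k) + c              ≡⟨ cong (λ x → suc m * x + c) (nCk+nC[k+1]≡[n+1]C[k+1] m k) ⟩
    suc m * c + c                                ≡⟨ +-comm (suc m * c) c ⟩
    suc (suc m) * c                              ∎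
    where
      c = suc m C suc k
      c′ = suc m C suc (suc k)
      split : ∀ k p q → suc (suc k) * (p + q) ≡ suc k * p + p + suc (suc k) * q
      split = solve-∀
      regroup : ∀ m x y p → suc m * x + p + suc m * y ≡ suc m * (x + y) + p
      regroup = solve-∀

  -- (k + 1) C(m, k + 1) = (m − k) C(m, k), written with m = j + k to avoid subtraction.
  [1+k]*[j+k]C[1+k]≡j*[j+k]Ck : ∀ j k → suc k * ((j + k) C suc k) ≡ j * ((j + k) C k)
  [1+k]*[j+k]C[1+k]≡j*[j+k]Ck j k = +-cancelʳ-≡ (suc k * c) _ _ (begin
    suc k * c′ + suc k * c   ≡⟨ *-distribˡ-+ (suc k) c′ c ⟨
    suc k * (c′ + c)         ≡⟨ cong (suc k *_) (trans (+-comm c′ c) (nCk+nC[k+1]≡[n+1]C[k+1] (j + k) k)) ⟩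
    suc k * (suc (j + k) C suc k) ≡⟨ absorption (j + k) k ⟩
    suc (j + k) * c         ≡⟨ split j k c ⟩
    j * c + suc k * c       ∎)
    where
      c = (j + k) C k
      c′ = (j + k) C suc k
      split : ∀ j k p → suc (j + k) * p ≡ j * p + suc k * p
      split = solve-∀

  [1+j]*catalan≡[2j]Cj : ∀ j → suc j * catalan j ≡ (2 * j) C j
  [1+j]*catalan≡[2j]Cj j = m*[n/m]≡n (divides (c ∸ c′) (begin
    c                       ≡⟨ m+n∸n≡m c (j * c) ⟨
    suc j * c ∸ j * c       ≡⟨ cong (suc j * c ∸_) ratio ⟨
    suc j * c ∸ suc j * c′   ≡⟨ *-distribˡ-∸ (suc j) c c′ ⟨
    suc j * (c ∸ c′)         ≡⟨ *-comm (suc j) (c ∸ c′) ⟩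
    (c ∸ c′) * suc j         ∎))
    where
      c = (2 * j) C j
      c′ = (2 * j) C suc j
      ratio : suc j * c′ ≡ j * c
      ratio = subst (λ m → suc j * (m C suc j) ≡ j * (m C j))
                    (cong (j +_) (sym (+-identityʳ j)))
                    ([1+k]*[j+k]C[1+k]≡j*[j+k]Ck j j)

  [9n+16]*catalan[1+n] : ∀ n → let M = n + suc n in
    (9 * n + 16) * catalan (suc n)
      ≡ 2 * (M C (2 + n) + 2 * (M C (1 + n)) + 2 * (M C (1 + n) + 2 * (M C n)))
  [9n+16]*catalan[1+n] n = *-cancelˡ-≡ _ _ (2 + n) (begin
    (2 + n) * ((9 * n + 16) * catalan (suc n))  ≡⟨ reassoc n (catalan (suc n)) ⟩
    (9 * n + 16) * ((2 + n) * catalan (suc n))  ≡⟨ cong ((9 * n + 16) *_) doubled ⟩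
    (9 * n + 16) * (2 * A)                      ≡⟨ cong (λ x → (9 * n + 16) * (2 * x)) symmetric ⟩
    (9 * n + 16) * (2 * A′)                     ≡⟨ expand n A′ ⟩
    2 * (n * A′) + 16 * ((2 + n) * A′)          ≡⟨ cong (λ x → 2 * x + 16 * ((2 + n) * A′)) tail ⟨
    2 * ((2 + n) * E) + 16 * ((2 + n) * A′)     ≡⟨ collect n E A′ ⟨
    (2 + n) * (2 * (E + 2 * A′ + 2 * (A′ + 2 * A′)))
      ≡⟨ cong (λ x → (2 + n) * (2 * (E + 2 * A′ + 2 * (A′ + 2 * x)))) symmetric ⟨
    (2 + n) * (2 * (E + 2 * A′ + 2 * (A′ + 2 * A))) ∎)
    where
      M = n + suc n
      A = M C n
      A′ = M C suc n
      E = M C suc (suc n)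
      symmetric : A ≡ A′
      symmetric = trans (nCk≡nC[n∸k] (m≤m+n n (suc n))) (cong (M C_) (m+n∸m≡n n (suc n)))
      doubled : (2 + n) * catalan (suc n) ≡ 2 * A
      doubled = begin
        (2 + n) * catalan (suc n) ≡⟨ [1+j]*catalan≡[2j]Cj (suc n) ⟩
        (2 * suc n) C suc n       ≡⟨ cong (_C suc n) (2[1+n]≡1+M n) ⟩
        suc M C suc n             ≡⟨ nCk+nC[k+1]≡[n+1]C[k+1] M n ⟨
        A + A′                    ≡⟨ cong (A +_) symmetric ⟨
        A + A                     ≡⟨ cong (A +_) (+-identityʳ A) ⟨
        2 * A                     ∎
        where
          2[1+n]≡1+M : ∀ n → 2 * suc n ≡ suc (n + suc n)
          2[1+n]≡1+M = solve-∀
      tail : (2 + n) * E ≡ n * A′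
      tail = [1+k]*[j+k]C[1+k]≡j*[j+k]Ck n (suc n)
      reassoc : ∀ n c → (2 + n) * ((9 * n + 16) * c) ≡ (9 * n + 16) * ((2 + n) * c)
      reassoc = solve-∀
      expand : ∀ n a → (9 * n + 16) * (2 * a) ≡ 2 * (n * a) + 16 * ((2 + n) * a)
      expand = solve-∀
      collect : ∀ n e a → (2 + n) * (2 * (e + 2 * a + 2 * (a + 2 * a))) ≡ 2 * ((2 + n) * e) + 16 * ((2 + n) * a)
      collect = solve-∀

open CatalanArithmetic using ([9n+16]*catalan[1+n])

import Data.Nat
open import Data.Nat as ℕ using (ℕ; zero; suc; _∸_; _≤_; z≤n)
import Data.Nat.Properties as ℕ
open import Data.Nat.Combinatorics using (_C_; nCk+nC[k+1]≡[n+1]C[k+1]; nCn≡1)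
open import Data.Integer using (ℤ; +_; -[1+_]; _+_; _*_; _-_; -_) renaming (suc to sucℤ)
import Data.Integer.Properties as ℤ
open import Algebra.Properties.AbelianGroup ℤ.+-0-abelianGroup using (∙-cancelʳ)
open import Data.Integer.Tactic.RingSolver using (solve-∀)
open import Data.Product using (_×_; _,_)
open import Relation.Binary.PropositionalEquality
open ≡-Reasoning

Series : Set
Series = ℕ → ℤ

_∗_ : Series → Series → Series
(f ∗ g) N = sumTo N (λ i → f i * g (N ∸ i))

shift : Series → Series
shift f zero = + 0
shift f (suc k) = f k

mul[1+cx] : ℤ → Series → Series
mul[1+cx] c f k = f k + c * shift f k

sumTo-cong : ∀ N {f g : Series} → (∀ i → i ≤ N → f i ≡ g i) → sumTo N f ≡ sumTo N g
sumTo-cong zero e = e 0 z≤n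
sumTo-cong (suc N) e = cong₂ _+_ (sumTo-cong N (λ i i≤N → e i (ℕ.m≤n⇒m≤1+n i≤N))) (e (suc N) ℕ.≤-refl)

sumTo-linear : ∀ N c (f g : Series) → sumTo N (λ i → f i + c * g i) ≡ sumTo N f + c * sumTo N g
sumTo-linear zero c f g = refl
sumTo-linear (suc N) c f g = begin
  sumTo N (λ i → f i + c * g i) + (f (suc N) + c * g (suc N))
    ≡⟨ cong (_+ (f (suc N) + c * g (suc N))) (sumTo-linear N c f g) ⟩
  sumTo N f + c * sumTo N g + (f (suc N) + c * g (suc N))
    ≡⟨ regroup (sumTo N f) (sumTo N g) (f (suc N)) (g (suc N)) c ⟩
  sumTo N f + f (suc N) + c * (sumTo N g + g (suc N)) ∎
  where
    regroup : ∀ s t x y c → s + c * t + (x + c * y) ≡ s + x + c * (t + y)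
    regroup = solve-∀

sumTo-suc : ∀ N (f : Series) → sumTo (suc N) f ≡ f 0 + sumTo N (λ i → f (suc i))
sumTo-suc zero f = refl
sumTo-suc (suc N) f = trans (cong (_+ f (suc (suc N))) (sumTo-suc N f)) (ℤ.+-assoc (f 0) _ _)

sumTo-zero : ∀ N → sumTo N (λ _ → + 0) ≡ + 0
sumTo-zero zero = refl
sumTo-zero (suc N) = cong (_+ + 0) (sumTo-zero N)

∗-cong : ∀ {f f′ g g′ : Series} → f ≗ f′ → g ≗ g′ → f ∗ g ≗ f′ ∗ g′
∗-cong f≗f′ g≗g′ N = sumTo-cong N (λ i _ → cong₂ _*_ (f≗f′ i) (g≗g′ (N ∸ i)))

∗-linearˡ : ∀ c (f f′ g : Series) N → ((λ i → f i + c * f′ i) ∗ g) N ≡ (f ∗ g) N + c * (f′ ∗ g) N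
∗-linearˡ c f f′ g N =
  trans (sumTo-cong N (λ i _ → distrib (f i) (f′ i) (g (N ∸ i)) c)) (sumTo-linear N c _ _)
  where
    distrib : ∀ x x′ y c → (x + c * x′) * y ≡ x * y + c * (x′ * y)
    distrib = solve-∀

∗-linearʳ : ∀ c (f g g′ : Series) N → (f ∗ (λ j → g j + c * g′ j)) N ≡ (f ∗ g) N + c * (f ∗ g′) N
∗-linearʳ c f g g′ N =
  trans (sumTo-cong N (λ i _ → distrib (f i) (g (N ∸ i)) (g′ (N ∸ i)) c)) (sumTo-linear N c _ _)
  where
    distrib : ∀ x y y′ c → x * (y + c * y′) ≡ x * y + c * (x * y′)
    distrib = solve-∀

shift-∗ˡ : ∀ (f g : Series) → shift f ∗ g ≗ shift (f ∗ g)
shift-∗ˡ f g zero = refl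
shift-∗ˡ f g (suc N) = trans (sumTo-suc N _) (ℤ.+-identityˡ _)

shift-∗ʳ : ∀ (f g : Series) → f ∗ shift g ≗ shift (f ∗ g)
shift-∗ʳ f g zero = ℤ.*-zeroʳ (f 0)
shift-∗ʳ f g (suc N) = begin
  sumTo N (λ i → f i * shift g (suc N ∸ i)) + f (suc N) * shift g (suc N ∸ suc N)
    ≡⟨ cong₂ _+_ (sumTo-cong N (λ i i≤N → cong (λ k → f i * shift g k) (ℕ.+-∸-assoc 1 i≤N)))
                 (trans (cong (λ k → f (suc N) * shift g k) (ℕ.n∸n≡0 N)) (ℤ.*-zeroʳ (f (suc N)))) ⟩
  (f ∗ g) N + + 0
    ≡⟨ ℤ.+-identityʳ _ ⟩
  (f ∗ g) N ∎

mul[1+cx]-∗ˡ : ∀ c (f g : Series) → mul[1+cx] c f ∗ g ≗ mul[1+cx] c (f ∗ g)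
mul[1+cx]-∗ˡ c f g N = trans (∗-linearˡ c f (shift f) g N) (cong (λ x → (f ∗ g) N + c * x) (shift-∗ˡ f g N))

mul[1+cx]-∗ʳ : ∀ c (f g : Series) → f ∗ mul[1+cx] c g ≗ mul[1+cx] c (f ∗ g)
mul[1+cx]-∗ʳ c f g N = trans (∗-linearʳ c f g (shift g) N) (cong (λ x → (f ∗ g) N + c * x) (shift-∗ʳ f g N))

mul[1+cx]-cong : ∀ c {f g : Series} → f ≗ g → mul[1+cx] c f ≗ mul[1+cx] c g
mul[1+cx]-cong c f≗g zero = cong (_+ c * + 0) (f≗g 0)
mul[1+cx]-cong c f≗g (suc k) = cong₂ (λ x y → x + c * y) (f≗g (suc k)) (f≗g k)

-- Coefficient k of (1 + c x) f(x) determines f k once f (k - 1) is known.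
mul[1+cx]-injective : ∀ c {f g : Series} → mul[1+cx] c f ≗ mul[1+cx] c g → f ≗ g
mul[1+cx]-injective c e zero = ∙-cancelʳ (c * + 0) _ _ (e zero)
mul[1+cx]-injective c {f} {g} e (suc k) =
  ∙-cancelʳ (c * g k) _ _ (trans (cong (λ x → f (suc k) + c * x) (sym (mul[1+cx]-injective c {f} {g} e k))) (e (suc k)))

binom-zero : ∀ a → binom a 0 ≡ + 1
binom-zero (+ n) = refl
binom-zero -[1+ m ] = refl

binom-pascal : ∀ a k → binom (sucℤ a) k ≡ binom a k + shift (binom a) k
binom-pascal a zero = trans (binom-zero (sucℤ a)) (sym (cong (_+ + 0) (binom-zero a)))
binom-pascal (+ n) (suc k) =
  trans (cong +_ (trans (sym (nCk+nC[k+1]≡[n+1]C[k+1] n k)) (ℕ.+-comm (n C k) _))) (ℤ.pos-+ (n C suc k) (n C k))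
binom-pascal -[1+ 0 ] (suc k) rewrite nCn≡1 (suc k) | nCn≡1 k = sym (cancel (sign k))
  where
    cancel : ∀ s → (- s) * + 1 + s * + 1 ≡ + 0
    cancel = solve-∀
binom-pascal -[1+ suc m ] (suc k) = begin
  (- sign k) * + ((m ℕ.+ suc k) C suc k)
    ≡⟨ cong (λ j → (- sign k) * + (j C suc k)) (ℕ.+-suc m k) ⟩
  (- sign k) * + x
    ≡⟨ regroup (sign k) (+ x) (+ y) ⟩
  (- sign k) * (+ y + + x) + sign k * + y
    ≡⟨ cong (λ j → (- sign k) * j + sign k * + y) (ℤ.pos-+ y x) ⟨
  (- sign k) * + (y ℕ.+ x) + sign k * + y
    ≡⟨ cong (λ j → (- sign k) * + j + sign k * + y) (nCk+nC[k+1]≡[n+1]C[k+1] (suc m ℕ.+ k) k) ⟩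
  (- sign k) * + (suc (suc m ℕ.+ k) C suc k) + sign k * + y
    ≡⟨ cong (λ j → (- sign k) * + (j C suc k) + sign k * + y) (ℕ.+-suc (suc m) k) ⟨
  (- sign k) * + ((suc m ℕ.+ suc k) C suc k) + sign k * + y ∎
  where
    x = (suc m ℕ.+ k) C suc k
    y = (suc m ℕ.+ k) C k
    regroup : ∀ s x y → (- s) * x ≡ (- s) * (y + x) + s * y
    regroup = solve-∀

binom-suc : ∀ a → binom (sucℤ a) ≗ mul[1+cx] (+ 1) (binom a)
binom-suc a k = trans (binom-pascal a k) (cong (λ x → binom a k + x) (sym (ℤ.*-identityˡ _)))

binom-0-∗ : ∀ (g : Series) → binom (+ 0) ∗ g ≗ g
binom-0-∗ g zero = ℤ.*-identityˡ (g 0)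
binom-0-∗ g (suc N) = begin
  (binom (+ 0) ∗ g) (suc N)                                    ≡⟨ sumTo-suc N _ ⟩
  + 1 * g (suc N) + sumTo N (λ i → + 0 * g (N ∸ i))            ≡⟨ cong₂ _+_ (ℤ.*-identityˡ (g (suc N))) vanish ⟩
  g (suc N) + + 0                                              ≡⟨ ℤ.+-identityʳ _ ⟩
  g (suc N)                                                    ∎
  where
    vanish : sumTo N (λ i → + 0 * g (N ∸ i)) ≡ + 0
    vanish = trans (sumTo-cong N (λ i _ → ℤ.*-zeroˡ (g (N ∸ i)))) (sumTo-zero N)

binom-suc-∗ : ∀ a (g : Series) → binom (sucℤ a) ∗ g ≗ mul[1+cx] (+ 1) (binom a ∗ g)
binom-suc-∗ a g N = trans (∗-cong {g = g} {g′ = g} (binom-suc a) (λ _ → refl) N) (mul[1+cx]-∗ˡ (+ 1) (binom a) g N)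

binom-suc-+ : ∀ a c → binom (sucℤ a + c) ≗ mul[1+cx] (+ 1) (binom (a + c))
binom-suc-+ a c k = trans (cong (λ s → binom s k) (ℤ.+-assoc (+ 1) a c)) (binom-suc (a + c) k)

vandermonde-suc : ∀ a c → binom a ∗ binom c ≗ binom (a + c) → binom (sucℤ a) ∗ binom c ≗ binom (sucℤ a + c)
vandermonde-suc a c vdm N =
  trans (binom-suc-∗ a (binom c) N) (trans (mul[1+cx]-cong (+ 1) vdm N) (sym (binom-suc-+ a c N)))

vandermonde-pred : ∀ a c → binom (sucℤ a) ∗ binom c ≗ binom (sucℤ a + c) → binom a ∗ binom c ≗ binom (a + c)
vandermonde-pred a c vdm = mul[1+cx]-injective (+ 1) λ N →
  trans (sym (binom-suc-∗ a (binom c) N)) (trans (vdm N) (binom-suc-+ a c N))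

vandermonde-ℕ : ∀ n c → binom (+ n) ∗ binom c ≗ binom (+ n + c)
vandermonde-ℕ zero c N = trans (binom-0-∗ (binom c) N) (cong (λ s → binom s N) (sym (ℤ.+-identityˡ c)))
vandermonde-ℕ (suc n) c = vandermonde-suc (+ n) c (vandermonde-ℕ n c)

vandermonde : ∀ a c → binom a ∗ binom c ≗ binom (a + c)
vandermonde (+ n) c = vandermonde-ℕ n c
vandermonde -[1+ zero ] c = vandermonde-pred -[1+ zero ] c (vandermonde-ℕ 0 c)
vandermonde -[1+ suc m ] c = vandermonde-pred -[1+ suc m ] c (vandermonde -[1+ m ] c)

b-column : ∀ n → (λ k → b k n) ≗ mul[1+cx] (+ 2) (binom n)
b-column n zero = refl
b-column n (suc k) = refl

b-columns-∗ : ∀ a c → (λ i → b i a) ∗ (λ j → b j c) ≗ mul[1+cx] (+ 2) (mul[1+cx] (+ 2) (binom (a + c)))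
b-columns-∗ a c N = begin
  ((λ i → b i a) ∗ (λ j → b j c)) N                      ≡⟨ ∗-cong (b-column a) (b-column c) N ⟩
  (mul[1+cx] (+ 2) (binom a) ∗ mul[1+cx] (+ 2) (binom c)) N ≡⟨ mul[1+cx]-∗ˡ (+ 2) (binom a) (mul[1+cx] (+ 2) (binom c)) N ⟩
  mul[1+cx] (+ 2) (binom a ∗ mul[1+cx] (+ 2) (binom c)) N   ≡⟨ mul[1+cx]-cong (+ 2) (mul[1+cx]-∗ʳ (+ 2) (binom a) (binom c)) N ⟩
  mul[1+cx] (+ 2) (mul[1+cx] (+ 2) (binom a ∗ binom c)) N   ≡⟨ mul[1+cx]-cong (+ 2) (mul[1+cx]-cong (+ 2) (vandermonde a c)) N ⟩
  mul[1+cx] (+ 2) (mul[1+cx] (+ 2) (binom (a + c))) N       ∎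

pos-[x+2y] : ∀ x y → + (x ℕ.+ 2 ℕ.* y) ≡ + x + + 2 * + y
pos-[x+2y] x y = trans (ℤ.pos-+ x (2 ℕ.* y)) (cong (λ z → + x + z) (ℤ.pos-* 2 y))

b-columns-∗-catalan : ∀ n a c → a + c ≡ + (n ℕ.+ suc n) →
  + (9 ℕ.* n ℕ.+ 16) * + catalan (suc n) ≡ + 2 * ((λ i → b i a) ∗ (λ j → b j c)) (n ℕ.+ 2)
b-columns-∗-catalan n a c a+c≡M = begin
  + (9 ℕ.* n ℕ.+ 16) * + catalan (suc n)                       ≡⟨ ℤ.pos-* (9 ℕ.* n ℕ.+ 16) _ ⟨
  + ((9 ℕ.* n ℕ.+ 16) ℕ.* catalan (suc n))                     ≡⟨ cong +_ ([9n+16]*catalan[1+n] n) ⟩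
  + (2 ℕ.* (E ℕ.+ 2 ℕ.* A′ ℕ.+ 2 ℕ.* (A′ ℕ.+ 2 ℕ.* A)))         ≡⟨ ℤ.pos-* 2 (E ℕ.+ 2 ℕ.* A′ ℕ.+ 2 ℕ.* (A′ ℕ.+ 2 ℕ.* A)) ⟩
  + 2 * + (E ℕ.+ 2 ℕ.* A′ ℕ.+ 2 ℕ.* (A′ ℕ.+ 2 ℕ.* A))          ≡⟨ cong (+ 2 *_) expand ⟩
  + 2 * mul[1+cx] (+ 2) (mul[1+cx] (+ 2) (binom (+ M))) (2 ℕ.+ n)
    ≡⟨ cong (λ s → + 2 * mul[1+cx] (+ 2) (mul[1+cx] (+ 2) (binom s)) (2 ℕ.+ n)) a+c≡M ⟨
  + 2 * mul[1+cx] (+ 2) (mul[1+cx] (+ 2) (binom (a + c))) (2 ℕ.+ n)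
    ≡⟨ cong (+ 2 *_) (b-columns-∗ a c (2 ℕ.+ n)) ⟨
  + 2 * ((λ i → b i a) ∗ (λ j → b j c)) (2 ℕ.+ n)              ≡⟨ cong (λ N → + 2 * ((λ i → b i a) ∗ (λ j → b j c)) N) (ℕ.+-comm 2 n) ⟩
  + 2 * ((λ i → b i a) ∗ (λ j → b j c)) (n ℕ.+ 2)              ∎
  where
    M = n ℕ.+ suc n
    A = M C n
    A′ = M C suc n
    E = M C suc (suc n)
    expand : + (E ℕ.+ 2 ℕ.* A′ ℕ.+ 2 ℕ.* (A′ ℕ.+ 2 ℕ.* A)) ≡ + E + + 2 * + A′ + + 2 * (+ A′ + + 2 * + A)
    expand = trans (pos-[x+2y] (E ℕ.+ 2 ℕ.* A′) (A′ ℕ.+ 2 ℕ.* A))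
                   (cong₂ (λ x y → x + + 2 * y) (pos-[x+2y] E A′) (pos-[x+2y] A′ A))

corollary8p7 : (n : ℕ) →
    ((+ (9 Data.Nat.* n Data.Nat.+ 16)) * + catalan (Data.Nat.suc n)
      ≡ + 2 * sumTo (n Data.Nat.+ 2) (λ i → b i (+ n) * b (n Data.Nat.+ 2 Data.Nat.∸ i) (+ n + + 1)))
    × ((l : ℤ) → (+ (9 Data.Nat.* n Data.Nat.+ 16)) * + catalan (Data.Nat.suc n)
      ≡ + 2 * sumTo (n Data.Nat.+ 2) (λ i → b i (+ n - l) * b (n Data.Nat.+ 2 Data.Nat.∸ i) (+ n + l + + 1)))
corollary8p7 n =
  b-columns-∗-catalan n (+ n) (+ n + + 1) n+[n+1]≡M ,
  λ l → b-columns-∗-catalan n (+ n - l) (+ n + l + + 1) (trans (balance (+ n) l) n+[n+1]≡M)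
  where
    n+[n+1]≡M : + n + (+ n + + 1) ≡ + (n ℕ.+ suc n)
    n+[n+1]≡M = cong (λ k → + (n ℕ.+ k)) (ℕ.+-comm n 1)
    balance : ∀ x l → (x - l) + (x + l + + 1) ≡ x + (x + + 1)
    balance = solve-∀
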